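{- Let $w\in S_n$ contain one of the patterns $3421$, $4312$, $4321$, $456123$. If $u=ws_k$ or $u=s_kw$ for some simple transposition $s_k=(k\ k+1)$, with $\ell(u)=\ell(w)+1$, then $u$ also contains one of these four patterns.
   Context: $\ell$ denotes Coxeter length (number of inversions). Pattern containment is classical permutation pattern containment. -}

module Defs where

open import Data.Nat using (ℕ; zero; suc; _<_; _<ᵇ_)
open import Data.Nat.Properties using (_<?_)
open import Data.Fin using (Fin; toℕ)
open import Data.Fin.Permutation using (Permutation′; _⟨$⟩ʳ_; _∘ₚ_; transpose)
open import Data.List using (List; []; _∷_; length; filter; allFin; cartesianProduct)
open import Data.Vec using (Vec; []; _∷_; lookup)
open import Data.Product using (Σ; ∃; _×_; _,_; proj₁; proj₂)
open import Data.Sum using (_⊎_)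
open import Relation.Binary.PropositionalEquality using (_≡_)
open import Function.Bundles using (_⇔_)
open import Relation.Nullary using (Dec)
open import Relation.Nullary.Decidable using (_×-dec_)

-- Elements of S_n: permutations of Fin n = {0,…,n-1} (positions/values 0-based).
-- One-line notation: w ⟨$⟩ʳ i is the value w(i+1)-1.

IsInversion : ∀ {n} → Permutation′ n → Fin n × Fin n → Set
IsInversion w (i , j) = (toℕ i < toℕ j) × (toℕ (w ⟨$⟩ʳ j) < toℕ (w ⟨$⟩ʳ i))

isInversion? : ∀ {n} (w : Permutation′ n) (p : Fin n × Fin n) → Dec (IsInversion w p)
isInversion? w (i , j) = (toℕ i <? toℕ j) ×-dec (toℕ (w ⟨$⟩ʳ j) <? toℕ (w ⟨$⟩ʳ i))

ℓ : ∀ {n} → Permutation′ n → ℕ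
ℓ {n} w = length (filter (isInversion? w) (cartesianProduct (allFin n) (allFin n)))

-- Simple transposition s_k = (k k+1), given by two adjacent positions k, k'
-- with toℕ k' ≡ suc (toℕ k).
-- Right multiplication w s_k : i ↦ w(s_k(i))  (note: π ∘ₚ ρ applies π first).
rightMul : ∀ {n} → Permutation′ n → Fin n → Fin n → Permutation′ n
rightMul w k k' = transpose k k' ∘ₚ w

leftMul : ∀ {n} → Fin n → Fin n → Permutation′ n → Permutation′ n
leftMul k k' w = w ∘ₚ transpose k k'

-- Classical pattern containment: w ∈ S_n contains the pattern p ∈ S_m
-- (p given in one-line notation as a vector of its values) iff there are
-- positions f(0) < … < f(m-1) such that w(f a) < w(f b) ⇔ p(a) < p(b).
Contains : ∀ {n m} → Permutation′ n → Vec ℕ m → Set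
Contains {n} {m} w p =
  Σ (Fin m → Fin n) λ f →
    (∀ a b → toℕ a < toℕ b → toℕ (f a) < toℕ (f b)) ×
    (∀ a b → (lookup p a < lookup p b) ⇔ (toℕ (w ⟨$⟩ʳ f a) < toℕ (w ⟨$⟩ʳ f b)))

p3421 : Vec ℕ 4
p3421 = 3 ∷ 4 ∷ 2 ∷ 1 ∷ []

p4312 : Vec ℕ 4
p4312 = 4 ∷ 3 ∷ 1 ∷ 2 ∷ []

p4321 : Vec ℕ 4
p4321 = 4 ∷ 3 ∷ 2 ∷ 1 ∷ []

p456123 : Vec ℕ 6
p456123 = 4 ∷ 5 ∷ 6 ∷ 1 ∷ 2 ∷ 3 ∷ []

ContainsOneOf : ∀ {n} → Permutation′ n → Set
ContainsOneOf w =
  Contains w p3421 ⊎ Contains w p4312 ⊎ Contains w p4321 ⊎ Contains w p456123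

-- If u = w s_k covers w, then w(k) < w(k+1); if u = s_k w covers w, then k stands to the left of
-- k+1 in w (otherwise the inversions of u map injectively into those of w, so ℓ u ≤ ℓ w).
-- Take an occurrence of a pattern q ∈ {3421, 4312, 4321, 456123} in w. If it does not use both
-- positions k, k+1 (respectively both values k, k+1), then s_k moves it to an occurrence of q in u.
-- Otherwise those two entries form an ascent a < b, q(a) < q(b) of q, and u contains q with the
-- entries at a and b exchanged. A finite check shows that each such exchange of one of the four
-- patterns again contains one of them.
module Submission where

open import Defs
open import Data.Nat using (ℕ; zero; suc; _+_; _<_; _≤_; z≤n; s≤s⁻¹)
open import Data.Nat.Properties
  using (_<?_; +-0-commutativeMonoid; +-mono-≤; ≤-refl; ≤-reflexive; <-irrefl; <-asym; <-trans; <-cmp;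
         n<1+n; <⇒≱; module ≤-Reasoning)
open import Data.Fin using (Fin; zero; suc; toℕ; _≟_)
open import Data.Fin.Patterns using (0F; 1F; 2F; 3F; 4F; 5F)
open import Data.Fin.Properties using (toℕ-injective; all?; any?)
open import Data.Fin.Permutation
  using (Permutation′; _⟨$⟩ʳ_; _⟨$⟩ˡ_; _≈_; inverseˡ; flip; transpose; id)
open import Data.Fin.Permutation.Components using () renaming (transpose to swap)
open import Data.List using (List; _++_; length; filter; map; tabulate; cartesianProduct; allFin)
open import Data.List.Properties using (length-++; filter-++; map-tabulate)
open import Data.List.Membership.Propositional.Properties using (∈-filter⁺; ∈-cartesianProduct⁺; ∈-allFin)
open import Data.List.Relation.Unary.All using (All; []; _∷_) renaming (lookup to All-lookup)
open import Data.Vec using (Vec; lookup; []; _∷_)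
open import Data.Product using (Σ; ∃₂; _×_; _,_)
open import Data.Sum using (_⊎_; inj₁; inj₂)
import Data.Sum as Sum
open import Data.Empty using (⊥-elim)
open import Function using (_∘_)
open import Function.Bundles using (_⇔_; mk⇔; Equivalence; Injection)
open import Function.Construct.Composition using (_⇔-∘_)
open import Function.Definitions using (Injective)
open import Function.Properties.Inverse using (↔⇒↣)
open import Relation.Binary.Definitions using (tri<; tri≈; tri>)
open import Relation.Binary.PropositionalEquality
open import Relation.Nullary using (Dec; yes; no; ¬_)
open import Relation.Nullary.Decidable using (True; toWitness; map′; _×-dec_; _→-dec_)
open import Relation.Unary using (Pred; Decidable)
open import Algebra.Properties.CommutativeMonoid.Sum +-0-commutativeMonoid using (sum; sum-permute)

data SwapView {n} (i j x y : Fin n) : Set where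
  at-i      : x ≡ i → y ≡ j → SwapView i j x y
  at-j      : x ≡ j → x ≢ i → y ≡ i → SwapView i j x y
  elsewhere : x ≢ i → x ≢ j → y ≡ x → SwapView i j x y

swapView : ∀ {n} (i j x : Fin n) → SwapView i j x (swap i j x)
swapView i j x with x ≟ i
... | yes x≡i = at-i x≡i refl
... | no x≢i with x ≟ j
...   | yes x≡j = at-j x≡j x≢i refl
...   | no x≢j = elsewhere x≢i x≢j refl

swap-matchˡ : ∀ {n} (i j : Fin n) → swap i j i ≡ j
swap-matchˡ i j with swapView i j i
... | at-i _ e = e
... | at-j _ i≢i _ = ⊥-elim (i≢i refl)
... | elsewhere i≢i _ _ = ⊥-elim (i≢i refl)

swap-matchʳ : ∀ {n} (i j : Fin n) → swap i j j ≡ i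
swap-matchʳ i j with swapView i j j
... | at-i j≡i e = trans e j≡i
... | at-j _ _ e = e
... | elsewhere _ j≢j _ = ⊥-elim (j≢j refl)

swap-involutive : ∀ {n} (i j x : Fin n) → swap i j (swap i j x) ≡ x
swap-involutive i j x with swapView i j x
... | at-i refl e = trans (cong (swap x j) e) (swap-matchʳ x j)
... | at-j refl _ e = trans (cong (swap i x) e) (swap-matchˡ i x)
... | elsewhere _ _ e = trans (cong (swap i j) e) e

swap-injective : ∀ {n} (i j : Fin n) → Injective _≡_ _≡_ (swap i j)
swap-injective i j {x} {y} e =
  trans (sym (swap-involutive i j x)) (trans (cong (swap i j) e) (swap-involutive i j y))

swap-conjugate : ∀ {m n} (h : Fin m → Fin n) → Injective _≡_ _≡_ h →
  ∀ a b c → swap (h a) (h b) (h c) ≡ h (swap a b c)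
swap-conjugate h h-inj a b c with swapView a b c
... | at-i refl e = trans (swap-matchˡ (h c) (h b)) (cong h (sym e))
... | at-j refl _ e = trans (swap-matchʳ (h a) (h c)) (cong h (sym e))
... | elsewhere c≢a c≢b e with swapView (h a) (h b) (h c)
...   | at-i hc≡ha _ = ⊥-elim (c≢a (h-inj hc≡ha))
...   | at-j hc≡hb _ _ = ⊥-elim (c≢b (h-inj hc≡hb))
...   | elsewhere _ _ e′ = trans e′ (cong h (sym e))

inverse-at : ∀ {n} (π : Permutation′ n) {i x} → π ⟨$⟩ʳ i ≡ x → π ⟨$⟩ˡ x ≡ i
inverse-at π refl = inverseˡ π

𝟙 : ∀ {a} {A : Set a} → Dec A → ℕ
𝟙 (yes _) = 1
𝟙 (no _) = 0

𝟙-mono : ∀ {a b} {A : Set a} {B : Set b} (A? : Dec A) (B? : Dec B) → (A → B) → 𝟙 A? ≤ 𝟙 B?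
𝟙-mono (yes a) (yes _) A→B = ≤-refl
𝟙-mono (yes a) (no ¬b) A→B with () ← ¬b (A→B a)
𝟙-mono (no _) B? A→B = z≤n

sum-mono-≤ : ∀ {n} {f g : Fin n → ℕ} → (∀ i → f i ≤ g i) → sum f ≤ sum g
sum-mono-≤ {zero} f≤g = z≤n
sum-mono-≤ {suc n} f≤g = +-mono-≤ (f≤g zero) (sum-mono-≤ (λ i → f≤g (suc i)))

length-filter-tabulate : ∀ {a} {A : Set a} {P : Pred A a} (P? : Decidable P) {n} (f : Fin n → A) →
  length (filter P? (tabulate f)) ≡ sum (λ i → 𝟙 (P? (f i)))
length-filter-tabulate P? {zero} f = refl
length-filter-tabulate P? {suc n} f with P? (f zero)
... | yes _ = cong suc (length-filter-tabulate P? (f ∘ suc))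
... | no _ = length-filter-tabulate P? (f ∘ suc)

length-filter-allPairs : ∀ {m n} {P : Pred (Fin m × Fin n) _} (P? : Decidable P) →
  length (filter P? (cartesianProduct (allFin m) (allFin n))) ≡ sum (λ i → sum (λ j → 𝟙 (P? (i , j))))
length-filter-allPairs {m} {n} P? = rows (λ i → i)
  where
    row : ∀ i → length (filter P? (map (i ,_) (allFin n))) ≡ sum (λ j → 𝟙 (P? (i , j)))
    row i = trans (cong (length ∘ filter P?) (map-tabulate (λ j → j) (i ,_)))
                  (length-filter-tabulate P? (i ,_))
    rows : ∀ {k} (g : Fin k → Fin m) →
      length (filter P? (cartesianProduct (tabulate g) (allFin n))) ≡ sum (λ i → sum (λ j → 𝟙 (P? (g i , j))))
    rows {zero} g = refl
    rows {suc k} g = begin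
        length (filter P? (first ++ rest))
      ≡⟨ cong length (filter-++ P? first rest) ⟩
        length (filter P? first ++ filter P? rest)
      ≡⟨ length-++ (filter P? first) ⟩
        length (filter P? first) + length (filter P? rest)
      ≡⟨ cong₂ _+_ (row (g zero)) (rows (g ∘ suc)) ⟩
        sum (λ j → 𝟙 (P? (g zero , j))) + sum (λ i → sum (λ j → 𝟙 (P? (g (suc i) , j))))
      ∎
      where
        open ≡-Reasoning
        first = map (g zero ,_) (allFin n)
        rest = cartesianProduct (tabulate (g ∘ suc)) (allFin n)

ℓ≡sum-inversions : ∀ {n} (w : Permutation′ n) →
  ℓ w ≡ sum (λ i → sum (λ j → 𝟙 (isInversion? w (i , j))))
ℓ≡sum-inversions w = length-filter-allPairs (isInversion? w)

ℓ-≤-by-relabelling : ∀ {n} (w u σ : Permutation′ n) →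
  (∀ i j → IsInversion u (σ ⟨$⟩ʳ i , σ ⟨$⟩ʳ j) → IsInversion w (i , j)) → ℓ u ≤ ℓ w
ℓ-≤-by-relabelling w u σ inv⇒inv = begin
    ℓ u
  ≡⟨ ℓ≡sum-inversions u ⟩
    sum (λ i → sum (λ j → 𝟙 (isInversion? u (i , j))))
  ≡⟨ sum-permute (λ i → sum (λ j → 𝟙 (isInversion? u (i , j)))) σ ⟩
    sum (λ i → sum (λ j → 𝟙 (isInversion? u (σ ⟨$⟩ʳ i , j))))
  ≤⟨ sum-mono-≤ (λ i → ≤-reflexive (sum-permute (λ j → 𝟙 (isInversion? u (σ ⟨$⟩ʳ i , j))) σ)) ⟩
    sum (λ i → sum (λ j → 𝟙 (isInversion? u (σ ⟨$⟩ʳ i , σ ⟨$⟩ʳ j))))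
  ≤⟨ sum-mono-≤ (λ i → sum-mono-≤ (λ j → 𝟙-mono (isInversion? u _) (isInversion? w _) (inv⇒inv i j))) ⟩
    sum (λ i → sum (λ j → 𝟙 (isInversion? w (i , j))))
  ≡⟨ ℓ≡sum-inversions w ⟨
    ℓ w ∎
  where open ≤-Reasoning
Increasing : ∀ {m n} → (Fin m → Fin n) → Set
Increasing f = ∀ a b → toℕ a < toℕ b → toℕ (f a) < toℕ (f b)

Increasing-reflects-< : ∀ {m n} {f : Fin m → Fin n} → Increasing f →
  ∀ a b → toℕ (f a) < toℕ (f b) → toℕ a < toℕ b
Increasing-reflects-< {f = f} f↑ a b fa<fb with <-cmp (toℕ a) (toℕ b)
... | tri< a<b _ _ = a<b
... | tri≈ _ a≡b _ = ⊥-elim (<-irrefl (cong (toℕ ∘ f) (toℕ-injective a≡b)) fa<fb)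
... | tri> _ _ b<a = ⊥-elim (<-asym fa<fb (f↑ b a b<a))

Increasing⇒injective : ∀ {m n} {f : Fin m → Fin n} → Increasing f → Injective _≡_ _≡_ f
Increasing⇒injective {f = f} f↑ {a} {b} fa≡fb with <-cmp (toℕ a) (toℕ b)
... | tri< a<b _ _ = ⊥-elim (<-irrefl (cong toℕ fa≡fb) (f↑ a b a<b))
... | tri≈ _ a≡b _ = toℕ-injective a≡b
... | tri> _ _ b<a = ⊥-elim (<-irrefl (cong toℕ (sym fa≡fb)) (f↑ b a b<a))

SameOrder : ∀ {m} → (Fin m → ℕ) → (Fin m → ℕ) → Set
SameOrder q r = ∀ a b → (q a < q b) ⇔ (r a < r b)

SameOrder-respʳ : ∀ {m} {q r r′ : Fin m → ℕ} → (∀ c → r c ≡ r′ c) → SameOrder q r → SameOrder q r′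
SameOrder-respʳ {q = q} r≗r′ q≅r a b =
  subst₂ (λ x y → (q a < q b) ⇔ (x < y)) (r≗r′ a) (r≗r′ b) (q≅r a b)

IsOccurrence : ∀ {m n} → (Fin n → ℕ) → (Fin m → ℕ) → (Fin m → Fin n) → Set
IsOccurrence xs q f = Increasing f × SameOrder q (xs ∘ f)

ContainsPattern : ∀ {m n} → (Fin n → ℕ) → (Fin m → ℕ) → Set
ContainsPattern {m} {n} xs q = Σ (Fin m → Fin n) (IsOccurrence xs q)

oneLine : ∀ {n} → Permutation′ n → Fin n → ℕ
oneLine w i = toℕ (w ⟨$⟩ʳ i)

ContainsPattern-refl : ∀ {m} {q : Fin m → ℕ} → ContainsPattern q q
ContainsPattern-refl = (λ c → c) , (λ _ _ a<b → a<b) , λ _ _ → mk⇔ (λ x → x) (λ x → x)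

ContainsPattern-trans : ∀ {m m′ n} {xs : Fin n → ℕ} {q : Fin m → ℕ} {r : Fin m′ → ℕ} →
  ContainsPattern xs q → ContainsPattern q r → ContainsPattern xs r
ContainsPattern-trans (f , f↑ , q≅xsf) (g , g↑ , r≅qg) =
  f ∘ g , (λ a b → f↑ (g a) (g b) ∘ g↑ a b) , λ c d → q≅xsf (g c) (g d) ⇔-∘ r≅qg c d

ContainsPattern-reindex : ∀ {m n} {q : Fin m → ℕ} (xs ys : Fin n → ℕ) (f g : Fin m → Fin n)
  (σ : Fin m → Fin m) → SameOrder q (xs ∘ f) → Increasing g →
  (∀ c → ys (g c) ≡ xs (f (σ c))) → ContainsPattern ys (q ∘ σ)
ContainsPattern-reindex xs ys f g σ q≅xsf g↑ ysg≡xsfσ =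
  g , g↑ , SameOrder-respʳ (λ c → sym (ysg≡xsfσ c)) (λ c d → q≅xsf (σ c) (σ d))

-- ContainsOneOfPattern (oneLine w) unfolds to ContainsOneOf w.
ContainsOneOfPattern : ∀ {n} → (Fin n → ℕ) → Set
ContainsOneOfPattern xs =
  ContainsPattern xs (lookup p3421) ⊎ ContainsPattern xs (lookup p4312) ⊎
  ContainsPattern xs (lookup p4321) ⊎ ContainsPattern xs (lookup p456123)

ContainsOneOfPattern-trans : ∀ {m n} {xs : Fin n → ℕ} {q : Fin m → ℕ} →
  ContainsPattern xs q → ContainsOneOfPattern q → ContainsOneOfPattern xs
ContainsOneOfPattern-trans {xs = xs} {q} xs⊇q = Sum.map ⊇q (Sum.map ⊇q (Sum.map ⊇q ⊇q))
  where
    ⊇q : ∀ {m′} {r : Fin m′ → ℕ} → ContainsPattern q r → ContainsPattern xs r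
    ⊇q = ContainsPattern-trans {xs = xs} xs⊇q

swapped : ∀ {m} → (Fin m → ℕ) → Fin m → Fin m → Fin m → ℕ
swapped q a b = q ∘ swap a b

AscentSwapsContainOneOf : ∀ {m} → (Fin m → ℕ) → Set
AscentSwapsContainOneOf q = ∀ a b → toℕ a < toℕ b → q a < q b → ContainsOneOfPattern (swapped q a b)

ascentPairs : ∀ {m} → (Fin m → ℕ) → List (Fin m × Fin m)
ascentPairs {m} q =
  filter (λ (a , b) → (toℕ a <? toℕ b) ×-dec (q a <? q b)) (cartesianProduct (allFin m) (allFin m))

ascentSwapsContainOneOf-byTable : ∀ {m} (q : Fin m → ℕ) →
  All (λ (a , b) → ContainsOneOfPattern (swapped q a b)) (ascentPairs q) → AscentSwapsContainOneOf q
ascentSwapsContainOneOf-byTable q table a b a<b qa<qb =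
  All-lookup table (∈-filter⁺ _ (∈-cartesianProduct⁺ (∈-allFin a) (∈-allFin b)) (a<b , qa<qb))

increasing? : ∀ {m n} (f : Fin m → Fin n) → Dec (Increasing f)
increasing? f = all? λ a → all? λ b → (toℕ a <? toℕ b) →-dec (toℕ (f a) <? toℕ (f b))

sameOrder? : ∀ {m} (q r : Fin m → ℕ) → Dec (SameOrder q r)
sameOrder? q r = all? λ a → all? λ b →
  map′ (λ (to , from) → mk⇔ to from) (λ q≅r → Equivalence.to q≅r , Equivalence.from q≅r)
       (((q a <? q b) →-dec (r a <? r b)) ×-dec ((r a <? r b) →-dec (q a <? q b)))

occurrenceAt : ∀ {m n} (xs : Fin n → ℕ) {q : Fin m → ℕ} (f : Vec (Fin n) m) →
  {True (increasing? (lookup f) ×-dec sameOrder? q (xs ∘ lookup f))} → ContainsPattern xs q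
occurrenceAt xs f {ok} = lookup f , toWitness ok

ascentSwaps-3421 : AscentSwapsContainOneOf (lookup p3421)
ascentSwaps-3421 = ascentSwapsContainOneOf-byTable (lookup p3421)
  ( inj₂ (inj₂ (inj₁ (occurrenceAt (swapped (lookup p3421) 0F 1F) (0F ∷ 1F ∷ 2F ∷ 3F ∷ []))))
  ∷ [])

ascentSwaps-4312 : AscentSwapsContainOneOf (lookup p4312)
ascentSwaps-4312 = ascentSwapsContainOneOf-byTable (lookup p4312)
  ( inj₂ (inj₂ (inj₁ (occurrenceAt (swapped (lookup p4312) 2F 3F) (0F ∷ 1F ∷ 2F ∷ 3F ∷ []))))
  ∷ [])

ascentSwaps-4321 : AscentSwapsContainOneOf (lookup p4321)
ascentSwaps-4321 = ascentSwapsContainOneOf-byTable (lookup p4321) []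

ascentSwaps-456123 : AscentSwapsContainOneOf (lookup p456123)
ascentSwaps-456123 = ascentSwapsContainOneOf-byTable (lookup p456123)
  -- 546123, 654123, 465123 contain 4312; 456213, 456321, 456132 contain 3421.
  ( inj₂ (inj₁ (occurrenceAt (swappedAt 0F 1F) (0F ∷ 1F ∷ 3F ∷ 4F ∷ [])))
  ∷ inj₂ (inj₁ (occurrenceAt (swappedAt 0F 2F) (0F ∷ 1F ∷ 3F ∷ 4F ∷ [])))
  ∷ inj₂ (inj₁ (occurrenceAt (swappedAt 1F 2F) (1F ∷ 2F ∷ 3F ∷ 4F ∷ [])))
  ∷ inj₁ (occurrenceAt (swappedAt 3F 4F) (0F ∷ 1F ∷ 3F ∷ 4F ∷ []))
  ∷ inj₁ (occurrenceAt (swappedAt 3F 5F) (0F ∷ 1F ∷ 3F ∷ 4F ∷ []))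
  ∷ inj₁ (occurrenceAt (swappedAt 4F 5F) (0F ∷ 1F ∷ 4F ∷ 5F ∷ []))
  ∷ [])
  where
    swappedAt : Fin 6 → Fin 6 → Fin 6 → ℕ
    swappedAt = swapped (lookup p456123)

ContainsAscentSwap : ∀ {m n} → (Fin n → ℕ) → (Fin m → ℕ) → Set
ContainsAscentSwap xs q = ∃₂ λ a b → toℕ a < toℕ b × q a < q b × ContainsPattern xs (swapped q a b)

module AdjacentTransposition {n} (k k′ : Fin n) (k′≡1+k : toℕ k′ ≡ suc (toℕ k)) where

  t : Fin n → Fin n
  t = swap k k′

  k<k′ : toℕ k < toℕ k′
  k<k′ = subst (toℕ k <_) (sym k′≡1+k) (n<1+n (toℕ k))

  t-reverses-only-kk′ : ∀ x y → toℕ x < toℕ y → toℕ (t y) < toℕ (t x) → x ≡ k × y ≡ k′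
  t-reverses-only-kk′ x y x<y ty<tx with swapView k k′ x | swapView k k′ y
  ... | at-i refl _ | at-i refl _ = ⊥-elim (<-irrefl refl x<y)
  ... | at-i refl _ | at-j refl _ _ = refl , refl
  ... | at-i refl ex | elsewhere _ _ ey rewrite ex | ey | k′≡1+k =
        ⊥-elim (<⇒≱ x<y (s≤s⁻¹ ty<tx))
  ... | at-j refl _ _ | at-i refl _ rewrite k′≡1+k = ⊥-elim (<-asym x<y (n<1+n _))
  ... | at-j refl _ _ | at-j refl _ _ = ⊥-elim (<-irrefl refl x<y)
  ... | at-j refl _ ex | elsewhere _ _ ey rewrite ex | ey | k′≡1+k =
        ⊥-elim (<-asym ty<tx (<-trans (n<1+n _) x<y))
  ... | elsewhere _ _ ex | at-i refl ey rewrite ex | ey | k′≡1+k =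
        ⊥-elim (<-asym x<y (<-trans (n<1+n _) ty<tx))
  ... | elsewhere _ _ ex | at-j refl _ ey rewrite ex | ey | k′≡1+k =
        ⊥-elim (<⇒≱ ty<tx (s≤s⁻¹ x<y))
  ... | elsewhere _ _ ex | elsewhere _ _ ey rewrite ex | ey = ⊥-elim (<-asym x<y ty<tx)

  t-mono : ∀ x y → ¬ (x ≡ k × y ≡ k′) → toℕ x < toℕ y → toℕ (t x) < toℕ (t y)
  t-mono x y ¬kk′ x<y with <-cmp (toℕ (t x)) (toℕ (t y))
  ... | tri< tx<ty _ _ = tx<ty
  ... | tri≈ _ tx≡ty _ = ⊥-elim (<-irrefl (cong toℕ (swap-injective k k′ (toℕ-injective tx≡ty))) x<y)
  ... | tri> _ _ ty<tx = ⊥-elim (¬kk′ (t-reverses-only-kk′ x y x<y ty<tx))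

  t-mono⁻¹ : ∀ x y → ¬ (x ≡ k′ × y ≡ k) → toℕ (t x) < toℕ (t y) → toℕ x < toℕ y
  t-mono⁻¹ x y ¬k′k tx<ty =
    subst₂ (λ a b → toℕ a < toℕ b) (swap-involutive k k′ x) (swap-involutive k k′ y)
      (t-mono (t x) (t y) ¬kk′ tx<ty)
    where
      ¬kk′ : ¬ (t x ≡ k × t y ≡ k′)
      ¬kk′ (tx≡k , ty≡k′) = ¬k′k
        ( trans (sym (swap-involutive k k′ x)) (trans (cong t tx≡k) (swap-matchˡ k k′))
        , trans (sym (swap-involutive k k′ y)) (trans (cong t ty≡k′) (swap-matchʳ k k′)))

  t-order : ∀ x y → ¬ (x ≡ k × y ≡ k′) → ¬ (x ≡ k′ × y ≡ k) →
    (toℕ x < toℕ y) ⇔ (toℕ (t x) < toℕ (t y))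
  t-order x y ¬kk′ ¬k′k = mk⇔ (t-mono x y ¬kk′) (t-mono⁻¹ x y ¬k′k)

  t-conjugate : ∀ {m} (h : Fin m → Fin n) → Injective _≡_ _≡_ h →
    ∀ {a b} → h a ≡ k → h b ≡ k′ → ∀ c → t (h c) ≡ h (swap a b c)
  t-conjugate h h-inj {a} {b} ha≡k hb≡k′ c =
    subst₂ (λ i j → swap i j (h c) ≡ h (swap a b c)) ha≡k hb≡k′ (swap-conjugate h h-inj a b c)

  rightMul-descent⇒ℓ≤ : (w u : Permutation′ n) → u ≈ rightMul w k k′ →
    toℕ (w ⟨$⟩ʳ k′) < toℕ (w ⟨$⟩ʳ k) → ℓ u ≤ ℓ w
  rightMul-descent⇒ℓ≤ w u u≈wt descent = ℓ-≤-by-relabelling w u (transpose k k′) inv⇒inv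
    where
      ut≡w : ∀ i → u ⟨$⟩ʳ t i ≡ w ⟨$⟩ʳ i
      ut≡w i = trans (u≈wt (t i)) (cong (w ⟨$⟩ʳ_) (swap-involutive k k′ i))
      inv⇒inv : ∀ i j → IsInversion u (t i , t j) → IsInversion w (i , j)
      inv⇒inv i j (ti<tj , utj<uti) = t-mono⁻¹ i j ¬k′k ti<tj , wj<wi
        where
          wj<wi : toℕ (w ⟨$⟩ʳ j) < toℕ (w ⟨$⟩ʳ i)
          wj<wi = subst₂ (λ a b → toℕ a < toℕ b) (ut≡w j) (ut≡w i) utj<uti
          ¬k′k : ¬ (i ≡ k′ × j ≡ k)
          ¬k′k (refl , refl) = <-asym wj<wi descent

  leftMul-descent⇒ℓ≤ : (w u : Permutation′ n) → u ≈ leftMul k k′ w →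
    toℕ (w ⟨$⟩ˡ k′) < toℕ (w ⟨$⟩ˡ k) → ℓ u ≤ ℓ w
  leftMul-descent⇒ℓ≤ w u u≈tw descent = ℓ-≤-by-relabelling w u id inv⇒inv
    where
      inv⇒inv : ∀ i j → IsInversion u (i , j) → IsInversion w (i , j)
      inv⇒inv i j (i<j , uj<ui) =
        i<j , t-mono⁻¹ (w ⟨$⟩ʳ j) (w ⟨$⟩ʳ i) ¬k′k (subst₂ (λ a b → toℕ a < toℕ b) (u≈tw j) (u≈tw i) uj<ui)
        where
          ¬k′k : ¬ (w ⟨$⟩ʳ j ≡ k′ × w ⟨$⟩ʳ i ≡ k)
          ¬k′k (wj≡k′ , wi≡k) =
            <-asym i<j (subst₂ (λ a b → toℕ a < toℕ b) (inverse-at w wj≡k′) (inverse-at w wi≡k) descent)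

  covering⇒ascent : ∀ {w u : Permutation′ n} (π : Permutation′ n) →
    (toℕ (π ⟨$⟩ʳ k′) < toℕ (π ⟨$⟩ʳ k) → ℓ u ≤ ℓ w) → ℓ u ≡ suc (ℓ w) →
    toℕ (π ⟨$⟩ʳ k) < toℕ (π ⟨$⟩ʳ k′)
  covering⇒ascent {w} {u} π descent⇒≤ ℓu≡1+ℓw with <-cmp (toℕ (π ⟨$⟩ʳ k)) (toℕ (π ⟨$⟩ʳ k′))
  ... | tri< πk<πk′ _ _ = πk<πk′
  ... | tri≈ _ πk≡πk′ _ =
        ⊥-elim (<-irrefl (cong toℕ (Injection.injective (↔⇒↣ π) (toℕ-injective πk≡πk′))) k<k′)
  ... | tri> _ _ πk′<πk = ⊥-elim (<-irrefl refl (subst (_≤ ℓ w) ℓu≡1+ℓw (descent⇒≤ πk′<πk)))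

  rightMul-covering⇒ascent : ∀ w u → u ≈ rightMul w k k′ → ℓ u ≡ suc (ℓ w) →
    toℕ (w ⟨$⟩ʳ k) < toℕ (w ⟨$⟩ʳ k′)
  rightMul-covering⇒ascent w u u≈wt = covering⇒ascent {w} {u} w (rightMul-descent⇒ℓ≤ w u u≈wt)

  leftMul-covering⇒ascent : ∀ w u → u ≈ leftMul k k′ w → ℓ u ≡ suc (ℓ w) →
    toℕ (w ⟨$⟩ˡ k) < toℕ (w ⟨$⟩ˡ k′)
  leftMul-covering⇒ascent w u u≈tw = covering⇒ascent {w} {u} (flip w) (leftMul-descent⇒ℓ≤ w u u≈tw)

  rightMul-occurrence : ∀ {m} w u {q : Fin m → ℕ} → u ≈ rightMul w k k′ → ℓ u ≡ suc (ℓ w) →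
    ContainsPattern (oneLine w) q → ContainsPattern (oneLine u) q ⊎ ContainsAscentSwap (oneLine u) q
  rightMul-occurrence w u {q} u≈wt covers (f , f↑ , q≅wf)
    with any? (λ a → f a ≟ k) ×-dec any? (λ b → f b ≟ k′)
  ... | yes ((a , fa≡k) , (b , fb≡k′)) =
        inj₂ (a , b , a<b , qa<qb , ContainsPattern-reindex (oneLine w) (oneLine u) f f (swap a b) q≅wf f↑ uf≡wfσ)
    where
      a<b : toℕ a < toℕ b
      a<b = Increasing-reflects-< f↑ a b (subst₂ (λ x y → toℕ x < toℕ y) (sym fa≡k) (sym fb≡k′) k<k′)
      qa<qb : q a < q b
      qa<qb = Equivalence.from (q≅wf a b)
        (subst₂ (λ x y → oneLine w x < oneLine w y) (sym fa≡k) (sym fb≡k′) (rightMul-covering⇒ascent w u u≈wt covers))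
      uf≡wfσ : ∀ c → oneLine u (f c) ≡ oneLine w (f (swap a b c))
      uf≡wfσ c = cong toℕ (trans (u≈wt (f c))
        (cong (w ⟨$⟩ʳ_) (t-conjugate f (Increasing⇒injective f↑) fa≡k fb≡k′ c)))
  ... | no ¬both = inj₁ (ContainsPattern-reindex (oneLine w) (oneLine u) f (t ∘ f) (λ c → c) q≅wf tf↑ utf≡wf)
    where
      tf↑ : Increasing (t ∘ f)
      tf↑ a b a<b = t-mono (f a) (f b) (λ (fa≡k , fb≡k′) → ¬both ((a , fa≡k) , (b , fb≡k′))) (f↑ a b a<b)
      utf≡wf : ∀ c → oneLine u (t (f c)) ≡ oneLine w (f c)
      utf≡wf c = cong toℕ (trans (u≈wt (t (f c))) (cong (w ⟨$⟩ʳ_) (swap-involutive k k′ (f c))))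

  leftMul-occurrence : ∀ {m} w u {q : Fin m → ℕ} → u ≈ leftMul k k′ w → ℓ u ≡ suc (ℓ w) →
    ContainsPattern (oneLine w) q → ContainsPattern (oneLine u) q ⊎ ContainsAscentSwap (oneLine u) q
  leftMul-occurrence w u {q} u≈tw covers (f , f↑ , q≅wf)
    with any? (λ a → w ⟨$⟩ʳ f a ≟ k) ×-dec any? (λ b → w ⟨$⟩ʳ f b ≟ k′)
  ... | yes ((a , wfa≡k) , (b , wfb≡k′)) =
        inj₂ (a , b , a<b , qa<qb , ContainsPattern-reindex (oneLine w) (oneLine u) f f (swap a b) q≅wf f↑ uf≡wfσ)
    where
      a<b : toℕ a < toℕ b
      a<b = Increasing-reflects-< f↑ a b
        (subst₂ (λ x y → toℕ x < toℕ y) (inverse-at w wfa≡k) (inverse-at w wfb≡k′) (leftMul-covering⇒ascent w u u≈tw covers))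
      qa<qb : q a < q b
      qa<qb = Equivalence.from (q≅wf a b) (subst₂ (λ x y → toℕ x < toℕ y) (sym wfa≡k) (sym wfb≡k′) k<k′)
      wf-injective : Injective _≡_ _≡_ (λ c → w ⟨$⟩ʳ f c)
      wf-injective = Increasing⇒injective f↑ ∘ Injection.injective (↔⇒↣ w)
      uf≡wfσ : ∀ c → oneLine u (f c) ≡ oneLine w (f (swap a b c))
      uf≡wfσ c = cong toℕ (trans (u≈tw (f c)) (t-conjugate (λ c → w ⟨$⟩ʳ f c) wf-injective wfa≡k wfb≡k′ c))
  ... | no ¬both = inj₁ (f , f↑ , SameOrder-respʳ (λ c → cong toℕ (sym (u≈tw (f c)))) q≅tw∘f)
    where
      q≅tw∘f : SameOrder q (λ c → toℕ (t (w ⟨$⟩ʳ f c)))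
      q≅tw∘f a b = t-order (w ⟨$⟩ʳ f a) (w ⟨$⟩ʳ f b)
          (λ (wfa≡k , wfb≡k′) → ¬both ((a , wfa≡k) , (b , wfb≡k′)))
          (λ (wfa≡k′ , wfb≡k) → ¬both ((b , wfb≡k) , (a , wfa≡k′)))
        ⇔-∘ q≅wf a b

  covering-occurrence : ∀ {m} w u {q : Fin m → ℕ} →
    u ≈ rightMul w k k′ ⊎ u ≈ leftMul k k′ w → ℓ u ≡ suc (ℓ w) →
    ContainsPattern (oneLine w) q → ContainsPattern (oneLine u) q ⊎ ContainsAscentSwap (oneLine u) q
  covering-occurrence w u {q} (inj₁ u≈wt) = rightMul-occurrence w u {q} u≈wt
  covering-occurrence w u {q} (inj₂ u≈tw) = leftMul-occurrence w u {q} u≈tw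

  covering-preserves : ∀ {m} w u {q : Fin m → ℕ} →
    u ≈ rightMul w k k′ ⊎ u ≈ leftMul k k′ w → ℓ u ≡ suc (ℓ w) →
    AscentSwapsContainOneOf q → ContainsOneOfPattern q →
    ContainsPattern (oneLine w) q → ContainsOneOfPattern (oneLine u)
  covering-preserves w u {q} u≈ covers swaps q⊇ w⊇q with covering-occurrence w u u≈ covers w⊇q
  ... | inj₁ u⊇q = ContainsOneOfPattern-trans {xs = oneLine u} u⊇q q⊇
  ... | inj₂ (a , b , a<b , qa<qb , u⊇q′) =
        ContainsOneOfPattern-trans {xs = oneLine u} u⊇q′ (swaps a b a<b qa<qb)

lemma4p5 : (n : ℕ) (w u : Permutation′ n) (k k' : Fin n) →
    toℕ k' ≡ suc (toℕ k) →
    ContainsOneOf w →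
    (u ≈ rightMul w k k' ⊎ u ≈ leftMul k k' w) →
    ℓ u ≡ suc (ℓ w) →
    ContainsOneOf u
lemma4p5 n w u k k' k'≡1+k w⊇ u≈ covers = preserved w⊇
  where
    open AdjacentTransposition k k' k'≡1+k
    preservedBy : ∀ {m} {q : Fin m → ℕ} → AscentSwapsContainOneOf q → ContainsOneOfPattern q →
      ContainsPattern (oneLine w) q → ContainsOneOf u
    preservedBy = covering-preserves w u u≈ covers
    preserved : ContainsOneOf w → ContainsOneOf u
    preserved (inj₁ w⊇) = preservedBy ascentSwaps-3421 (inj₁ ContainsPattern-refl) w⊇
    preserved (inj₂ (inj₁ w⊇)) = preservedBy ascentSwaps-4312 (inj₂ (inj₁ ContainsPattern-refl)) w⊇
    preserved (inj₂ (inj₂ (inj₁ w⊇))) = preservedBy ascentSwaps-4321 (inj₂ (inj₂ (inj₁ ContainsPattern-refl))) w⊇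
    preserved (inj₂ (inj₂ (inj₂ w⊇))) = preservedBy ascentSwaps-456123 (inj₂ (inj₂ (inj₂ ContainsPattern-refl))) w⊇
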